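{- Let $m,n$ be positive integers with $3m\le n$ and let $\Gamma_m$ be the collinearity graph of $\mathcal{P}_m$. Then: (A) If $n=3m$, the maximal cliques of $\Gamma_m$ are precisely the lines of $\mathcal{P}_m$. (B) Assume $n\ge 3m+1$. If $n=7$ and $m=2$, then $\mathcal{P}_m$ is a polar space (i.e. satisfies the one-or-all axiom: every point is collinear to exactly one or to all points of any given line). In all remaining cases with $n\ge 3m+1$, for any two distinct collinear points $P,P'\in\mathcal{P}_m$ there is a point $Q\in\mathcal{P}_m$ collinear to both $P$ and $P'$ and non-collinear to $P\odot P'$.
   Context: $\mathbb{F}$ is the two-element field, $V=\mathbb{F}^n$, $[n]=\{1,\dots,n\}$. For non-empty $I\subseteq[n]$, $e_I=\sum_{i\in I}e_i$ and $P_I$ is the point of $\mathcal{P}(V)$ spanned by $e_I$; for distinct points $P,Q$ of $\mathcal{P}(V)$, $P\odot Q$ is the third point on the line through them, so $P_I\odot P_J=P_{I\triangle J}$. $\mathcal{P}_m$ is the point-line geometry whose points are all $P_I$ with $|I|=2m$ and whose lines are the 3-point lines of $\mathcal{P}(V)$ contained in this point set; distinct points $P_I,P_J$ are collinear iff $|I\cap J|=m$. The collinearity graph has the points as vertices, with distinct collinear points adjacent; a clique is a set of pairwise adjacent vertices, maximal if not properly contained in another clique. -}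

module Defs where

open import Data.Nat using (ℕ; _*_)
open import Data.Bool using (Bool; true; _xor_)
open import Data.Vec using (zipWith)
open import Data.Fin.Subset using (Subset; ∣_∣)
open import Data.Product using (Σ; _×_; ∃₂)
open import Data.Sum using (_⊎_)
open import Relation.Binary.PropositionalEquality using (_≡_; _≢_)
open import Relation.Nullary using (¬_)
open import Function.Bundles using (_⇔_)

-- A subset I ⊆ [n] is encoded as a bit vector, i.e. the vector e_I ∈ 𝔽₂ⁿ.
-- The point P_I of P(V) is identified with I (I non-empty).

-- e_I + e_J = e_{I △ J} : the third point P_I ⊙ P_J of the line through P_I, P_J.
_△_ : ∀ {n} → Subset n → Subset n → Subset n
I △ J = zipWith _xor_ I J

IsPoint : ∀ {n} → ℕ → Subset n → Set
IsPoint m I = ∣ I ∣ ≡ 2 * m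

-- distinct points P_I, P_J of 𝒫_m are collinear iff the 3-point line
-- {P_I, P_J, P_I ⊙ P_J} of P(V) lies in the point set of 𝒫_m.
-- (This is exactly adjacency in the collinearity graph Γ_m.)
Collinear : ∀ {n} → ℕ → Subset n → Subset n → Set
Collinear m I J = IsPoint m I × IsPoint m J × I ≢ J × IsPoint m (I △ J)

_∼[_]_ : ∀ {n} → Subset n → ℕ → Subset n → Set
I ∼[ m ] J = I ≡ J ⊎ Collinear m I J

PointSet : ℕ → Set
PointSet n = Subset n → Bool

_∈ₛ_ : ∀ {n} → Subset n → PointSet n → Set
I ∈ₛ C = C I ≡ true

IsClique : ∀ {n} → ℕ → PointSet n → Set
IsClique {n} m C =
  (∀ I → I ∈ₛ C → IsPoint m I) ×
  (∀ I J → I ∈ₛ C → J ∈ₛ C → I ≢ J → Collinear m I J)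

IsMaximalClique : ∀ {n} → ℕ → PointSet n → Set
IsMaximalClique {n} m C =
  IsClique m C ×
  (∀ (D : PointSet n) → IsClique m D → (∀ I → I ∈ₛ C → I ∈ₛ D) → ∀ I → I ∈ₛ D → I ∈ₛ C)

OnLine : ∀ {n} → Subset n → Subset n → Subset n → Set
OnLine I J X = X ≡ I ⊎ X ≡ J ⊎ X ≡ I △ J

IsLine : ∀ {n} → ℕ → PointSet n → Set
IsLine {n} m C = ∃₂ λ I J → Collinear m I J × (∀ X → (X ∈ₛ C) ⇔ OnLine I J X)

OneOrAll : ℕ → ℕ → Set
OneOrAll n m =
  ∀ (I J : Subset n) → Collinear m I J →
  ∀ (P : Subset n) → IsPoint m P →
    (∀ X → OnLine I J X → P ∼[ m ] X)
    ⊎ (Σ (Subset n) λ X → OnLine I J X × P ∼[ m ] X ×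
         (∀ Y → OnLine I J Y → P ∼[ m ] Y → Y ≡ X))

IsPolarSpace : ℕ → ℕ → Set
IsPolarSpace n m = OneOrAll n m

WitnessProperty : ℕ → ℕ → Set
WitnessProperty n m =
  ∀ (P P' : Subset n) → Collinear m P P' →
    Σ (Subset n) λ Q → IsPoint m Q × Collinear m Q P × Collinear m Q P' ×
      ¬ (Q ∼[ m ] (P △ P'))

{-# OPTIONS --safe #-}
-- Everything is counted on the Venn diagram of three subsets, whose eight region sizes give the
-- sizes of all their 𝔽₂-combinations.
-- (A) For pairwise collinear X, I, J the six sizes of X, I, J, X △ I, X △ J, I △ J add up to 12m,
-- while every coordinate of X ∪ I ∪ J lies in exactly four of the seven non-empty combinations;
-- so ∣X △ I △ J∣ ≤ 4n − 12m = 0, i.e. X is the third point of the line IJ. Hence lines are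
-- maximal cliques, and every clique lies on a line.
-- (B) For n = 7, m = 2 a point P is collinear or equal to a point X iff ∣P ∩ X∣ is even; as
-- X ↦ ∣P ∩ X∣ mod 2 is 𝔽₂-linear, it vanishes at one or at all three points of a line.
-- Otherwise write m = t + s with 1 ≤ t ≠ s and 3m + t ≤ n; a point Q with t points in P ∩ P′,
-- s in P ─ P′, s in P′ ─ P and t outside P ∪ P′ is collinear with P and P′ and lies at
-- distance 4t ∉ {0, 2m} from P △ P′.
module Submission where

open import Defs
open import Data.Nat using (ℕ; zero; suc; _+_; _*_; _⊓_; _≤_; z≤n; s≤s)
open import Data.Nat.Properties
open import Data.Nat.Tactic.RingSolver using (solve-∀)
open import Data.Bool using (Bool; true; false; not; if_then_else_; _xor_; _∧_; _∨_)
import Data.Bool.Properties as Bool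
open import Data.Maybe using (Maybe; just; nothing; fromMaybe)
open import Data.Vec using (Vec; []; _∷_)
open import Data.Vec.Properties using (≡-dec; zipWith-comm; zipWith-assoc; zipWith-identityˡ)
open import Data.Fin.Subset using (Subset; ∣_∣; ⊤; _∩_; _∪_) renaming (⊥ to ∅)
open import Data.Fin.Subset.Properties using (∣⊥∣≡0; ∣⊤∣≡n; ∣p∣≤n; anySubset?)
open import Data.Product as Product using (Σ; ∃; ∃₂; _×_; _,_; proj₁; proj₂)
open import Data.Sum using (_⊎_; inj₁; inj₂; [_,_]′)
open import Data.Empty using (⊥-elim)
open import Function using (_∘_; id)
open import Function.Bundles using (_⇔_; mk⇔; Equivalence)
open import Function.Construct.Composition using (_⇔-∘_)
open import Relation.Binary.Definitions using (DecidableEquality)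
open import Relation.Binary.PropositionalEquality
open import Relation.Nullary using (¬_; yes; no; does)
open import Relation.Nullary.Decidable using (_×-dec_; ¬?; decidable-stable)
open import Algebra.Properties.CommutativeSemigroup +-commutativeSemigroup using (x∙yz≈y∙xz)

open Equivalence using (to; from)

_≟ₛ_ : ∀ {n} → DecidableEquality (Subset n)
_≟ₛ_ = ≡-dec Bool._≟_

△-comm : ∀ {n} (I J : Subset n) → I △ J ≡ J △ I
△-comm = zipWith-comm Bool.xor-comm

△-self : ∀ {n} (I : Subset n) → I △ I ≡ ∅
△-self []      = refl
△-self (x ∷ I) = cong₂ _∷_ (Bool.xor-same x) (△-self I)

△-cancelˡ : ∀ {n} (I J : Subset n) → I △ (I △ J) ≡ J
△-cancelˡ I J = begin
  I △ (I △ J) ≡⟨ zipWith-assoc Bool.xor-assoc I I J ⟨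
  (I △ I) △ J ≡⟨ cong (_△ J) (△-self I) ⟩
  ∅ △ J       ≡⟨ zipWith-identityˡ Bool.xor-identityˡ J ⟩
  J           ∎
  where open ≡-Reasoning

∣△-self∣ : ∀ {n} (I : Subset n) → ∣ I △ I ∣ ≡ 0
∣△-self∣ {n} I = trans (cong ∣_∣ (△-self I)) (∣⊥∣≡0 n)

∣△∣≡0⇒≡ : ∀ {n} (I J : Subset n) → ∣ I △ J ∣ ≡ 0 → I ≡ J
∣△∣≡0⇒≡ []          []          _  = refl
∣△∣≡0⇒≡ (true ∷ I)  (true ∷ J)  eq = cong (true ∷_) (∣△∣≡0⇒≡ I J eq)
∣△∣≡0⇒≡ (false ∷ I) (false ∷ J) eq = cong (false ∷_) (∣△∣≡0⇒≡ I J eq)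
∣△∣≡0⇒≡ (true ∷ I)  (false ∷ J) ()
∣△∣≡0⇒≡ (false ∷ I) (true ∷ J)  ()

subsetOfSize : ∀ {n k} → k ≤ n → Σ (Subset n) λ p → ∣ p ∣ ≡ k
subsetOfSize {zero}          z≤n       = [] , refl
subsetOfSize {suc n} {zero}  z≤n       = ∅ , ∣⊥∣≡0 (suc n)
subsetOfSize {suc n} {suc k} (s≤s k≤n) = Product.map (true ∷_) (cong suc) (subsetOfSize k≤n)

-- Venn diagrams

-- Counts k assigns a number to each of the 2^k membership patterns of k sets; in a pair the first
-- component collects the patterns inside the first set.
Counts : ℕ → Set
Counts zero    = ℕ
Counts (suc k) = Counts k × Counts k

nought : ∀ {k} → Counts k
nought {zero}  = 0
nought {suc k} = nought , nought

tally : ∀ {k} → Vec Bool k → Counts k → Counts k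
tally []           c         = suc c
tally (true  ∷ bs) (c₁ , c₂) = tally bs c₁ , c₂
tally (false ∷ bs) (c₁ , c₂) = c₁ , tally bs c₂

-- Sums are kept in Maybe so that, for a concrete φ, weigh φ normalises to the plain sum of the
-- selected regions, with no "+ 0" terms.
_⊕_ : Maybe ℕ → Maybe ℕ → Maybe ℕ
nothing ⊕ y       = y
just x  ⊕ nothing = just x
just x  ⊕ just y  = just (x + y)

weigh : ∀ {k} → (Vec Bool k → Bool) → Counts k → Maybe ℕ
weigh {zero}  φ c         = if φ [] then just c else nothing
weigh {suc k} φ (c₁ , c₂) = weigh (φ ∘ (true ∷_)) c₁ ⊕ weigh (φ ∘ (false ∷_)) c₂

total : Maybe ℕ → ℕ
total = fromMaybe 0

bit : Bool → ℕ
bit b = if b then 1 else 0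

total-⊕ : ∀ x y → total (x ⊕ y) ≡ total x + total y
total-⊕ nothing  y        = refl
total-⊕ (just x) nothing  = sym (+-identityʳ x)
total-⊕ (just x) (just y) = refl

total-weigh-nought : ∀ {k} (φ : Vec Bool k → Bool) → total (weigh φ nought) ≡ 0
total-weigh-nought {zero}  φ with φ []
... | true  = refl
... | false = refl
total-weigh-nought {suc k} φ = begin
  total (weigh φ₁ nought ⊕ weigh φ₂ nought)       ≡⟨ total-⊕ (weigh φ₁ nought) (weigh φ₂ nought) ⟩
  total (weigh φ₁ nought) + total (weigh φ₂ nought) ≡⟨ cong₂ _+_ (total-weigh-nought φ₁) (total-weigh-nought φ₂) ⟩
  0                                                ∎
  where
  open ≡-Reasoning
  φ₁ = φ ∘ (true ∷_)
  φ₂ = φ ∘ (false ∷_)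

total-weigh-tally : ∀ {k} (φ : Vec Bool k → Bool) bs c →
  total (weigh φ (tally bs c)) ≡ bit (φ bs) + total (weigh φ c)
total-weigh-tally {zero} φ [] c with φ []
... | true  = refl
... | false = refl
total-weigh-tally {suc k} φ (true ∷ bs) (c₁ , c₂) = begin
  total (w₁′ ⊕ w₂)          ≡⟨ total-⊕ w₁′ w₂ ⟩
  total w₁′ + total w₂      ≡⟨ cong (_+ total w₂) (total-weigh-tally φ₁ bs c₁) ⟩
  (b + total w₁) + total w₂ ≡⟨ +-assoc b (total w₁) (total w₂) ⟩
  b + (total w₁ + total w₂) ≡⟨ cong (b +_) (total-⊕ w₁ w₂) ⟨
  b + total (w₁ ⊕ w₂)       ∎
  where
  open ≡-Reasoning
  φ₁ = φ ∘ (true ∷_)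
  b = bit (φ₁ bs)
  w₁ = weigh φ₁ c₁
  w₁′ = weigh φ₁ (tally bs c₁)
  w₂ = weigh (φ ∘ (false ∷_)) c₂
total-weigh-tally {suc k} φ (false ∷ bs) (c₁ , c₂) = begin
  total (w₁ ⊕ w₂′)          ≡⟨ total-⊕ w₁ w₂′ ⟩
  total w₁ + total w₂′      ≡⟨ cong (total w₁ +_) (total-weigh-tally φ₂ bs c₂) ⟩
  total w₁ + (b + total w₂) ≡⟨ x∙yz≈y∙xz (total w₁) b (total w₂) ⟩
  b + (total w₁ + total w₂) ≡⟨ cong (b +_) (total-⊕ w₁ w₂) ⟨
  b + total (w₁ ⊕ w₂)       ∎
  where
  open ≡-Reasoning
  φ₂ = φ ∘ (false ∷_)
  b = bit (φ₂ bs)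
  w₁ = weigh (φ ∘ (true ∷_)) c₁
  w₂ = weigh φ₂ c₂
  w₂′ = weigh φ₂ (tally bs c₂)

venn : ∀ {n} → Subset n → Subset n → Subset n → Counts 3
venn []      []      []      = nought
venn (x ∷ X) (y ∷ Y) (z ∷ Z) = tally (x ∷ y ∷ z ∷ []) (venn X Y Z)

∣∷∣ : ∀ {n} b (p : Subset n) → ∣ b ∷ p ∣ ≡ bit b + ∣ p ∣
∣∷∣ true  p = refl
∣∷∣ false p = refl

∣[]∣ : (p : Subset 0) → ∣ p ∣ ≡ 0
∣[]∣ [] = refl

∣pointwise∣ : (φ : Vec Bool 3 → Bool) (F : ∀ {n} → Subset n → Subset n → Subset n → Subset n) →
  (∀ {n} x y z (X Y Z : Subset n) → F (x ∷ X) (y ∷ Y) (z ∷ Z) ≡ φ (x ∷ y ∷ z ∷ []) ∷ F X Y Z) →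
  ∀ {n} (X Y Z : Subset n) → ∣ F X Y Z ∣ ≡ total (weigh φ (venn X Y Z))
∣pointwise∣ φ F F-∷ [] [] [] = trans (∣[]∣ (F [] [] [])) (sym (total-weigh-nought φ))
∣pointwise∣ φ F F-∷ (x ∷ X) (y ∷ Y) (z ∷ Z) = begin
  ∣ F (x ∷ X) (y ∷ Y) (z ∷ Z) ∣               ≡⟨ cong ∣_∣ (F-∷ x y z X Y Z) ⟩
  ∣ φ xyz ∷ F X Y Z ∣                         ≡⟨ ∣∷∣ (φ xyz) (F X Y Z) ⟩
  bit (φ xyz) + ∣ F X Y Z ∣                   ≡⟨ cong (bit (φ xyz) +_) (∣pointwise∣ φ F F-∷ X Y Z) ⟩
  bit (φ xyz) + total (weigh φ (venn X Y Z))  ≡⟨ total-weigh-tally φ xyz (venn X Y Z) ⟨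
  total (weigh φ (venn (x ∷ X) (y ∷ Y) (z ∷ Z))) ∎
  where
  open ≡-Reasoning
  xyz = x ∷ y ∷ z ∷ []

module Venn {n} (X Y Z : Subset n) where

  private
    v = venn X Y Z

  -- the numbers of coordinates with membership pattern 111, 110, 101, 100, 011, 010, 001, 000 in (X, Y, Z)
  a b c d e f g h : ℕ
  a = proj₁ (proj₁ (proj₁ v))
  b = proj₂ (proj₁ (proj₁ v))
  c = proj₁ (proj₂ (proj₁ v))
  d = proj₂ (proj₂ (proj₁ v))
  e = proj₁ (proj₁ (proj₂ v))
  f = proj₂ (proj₁ (proj₂ v))
  g = proj₁ (proj₂ (proj₂ v))
  h = proj₂ (proj₂ (proj₂ v))

  ∣X∣ : ∣ X ∣ ≡ (a + b) + (c + d)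
  ∣X∣ = ∣pointwise∣ (λ { (x ∷ _) → x }) (λ X _ _ → X)
    (λ _ _ _ _ _ _ → refl) X Y Z

  ∣Y∣ : ∣ Y ∣ ≡ (a + b) + (e + f)
  ∣Y∣ = ∣pointwise∣ (λ { (_ ∷ y ∷ _) → y }) (λ _ Y _ → Y)
    (λ _ _ _ _ _ _ → refl) X Y Z

  ∣Z∣ : ∣ Z ∣ ≡ (a + c) + (e + g)
  ∣Z∣ = ∣pointwise∣ (λ { (_ ∷ _ ∷ z ∷ _) → z }) (λ _ _ Z → Z)
    (λ _ _ _ _ _ _ → refl) X Y Z

  ∣X△Y∣ : ∣ X △ Y ∣ ≡ (c + d) + (e + f)
  ∣X△Y∣ = ∣pointwise∣ (λ { (x ∷ y ∷ _) → x xor y }) (λ X Y _ → X △ Y)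
    (λ _ _ _ _ _ _ → refl) X Y Z

  ∣X△Z∣ : ∣ X △ Z ∣ ≡ (b + d) + (e + g)
  ∣X△Z∣ = ∣pointwise∣ (λ { (x ∷ _ ∷ z ∷ _) → x xor z }) (λ X _ Z → X △ Z)
    (λ _ _ _ _ _ _ → refl) X Y Z

  ∣Y△Z∣ : ∣ Y △ Z ∣ ≡ (b + c) + (f + g)
  ∣Y△Z∣ = ∣pointwise∣ (λ { (_ ∷ y ∷ z ∷ _) → y xor z }) (λ _ Y Z → Y △ Z)
    (λ _ _ _ _ _ _ → refl) X Y Z

  ∣X△[Y△Z]∣ : ∣ X △ (Y △ Z) ∣ ≡ (a + d) + (f + g)
  ∣X△[Y△Z]∣ = ∣pointwise∣ (λ { (x ∷ y ∷ z ∷ _) → x xor (y xor z) }) (λ X Y Z → X △ (Y △ Z))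
    (λ _ _ _ _ _ _ → refl) X Y Z

  ∣X∪[Y∪Z]∣ : ∣ X ∪ (Y ∪ Z) ∣ ≡ ((a + b) + (c + d)) + ((e + f) + g)
  ∣X∪[Y∪Z]∣ = ∣pointwise∣ (λ { (x ∷ y ∷ z ∷ _) → x ∨ (y ∨ z) }) (λ X Y Z → X ∪ (Y ∪ Z))
    (λ _ _ _ _ _ _ → refl) X Y Z

  ∣X∩Y∣ : ∣ X ∩ Y ∣ ≡ a + b
  ∣X∩Y∣ = ∣pointwise∣ (λ { (x ∷ y ∷ _) → x ∧ y }) (λ X Y _ → X ∩ Y)
    (λ _ _ _ _ _ _ → refl) X Y Z

  ∣X∩Z∣ : ∣ X ∩ Z ∣ ≡ a + c
  ∣X∩Z∣ = ∣pointwise∣ (λ { (x ∷ _ ∷ z ∷ _) → x ∧ z }) (λ X _ Z → X ∩ Z)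
    (λ _ _ _ _ _ _ → refl) X Y Z

  ∣X∩[Y△Z]∣ : ∣ X ∩ (Y △ Z) ∣ ≡ b + c
  ∣X∩[Y△Z]∣ = ∣pointwise∣ (λ { (x ∷ y ∷ z ∷ _) → x ∧ (y xor z) }) (λ X Y Z → X ∩ (Y △ Z))
    (λ _ _ _ _ _ _ → refl) X Y Z

  ∣⊤∣ : n ≡ ((a + b) + (c + d)) + ((e + f) + (g + h))
  ∣⊤∣ = trans (sym (∣⊤∣≡n n))
    (∣pointwise∣ (λ _ → true) (λ _ _ _ → ⊤) (λ _ _ _ _ _ _ → refl) X Y Z)

  -- A coordinate in X ∪ Y ∪ Z lies in exactly four of the seven non-empty 𝔽₂-combinations of X, Y, Z.
  ∣combinations∣ :
    ∣ X ∣ + ∣ Y ∣ + ∣ Z ∣ + ∣ X △ Y ∣ + ∣ X △ Z ∣ + ∣ Y △ Z ∣ + ∣ X △ (Y △ Z) ∣ ≡ 4 * ∣ X ∪ (Y ∪ Z) ∣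
  ∣combinations∣
    rewrite ∣X∣ | ∣Y∣ | ∣Z∣ | ∣X△Y∣ | ∣X△Z∣ | ∣Y△Z∣ | ∣X△[Y△Z]∣ | ∣X∪[Y∪Z]∣ = regions a b c d e f g
    where
    regions : ∀ a b c d e f g →
      (a + b) + (c + d) + ((a + b) + (e + f)) + ((a + c) + (e + g)) + ((c + d) + (e + f))
        + ((b + d) + (e + g)) + ((b + c) + (f + g)) + ((a + d) + (f + g))
        ≡ 4 * (((a + b) + (c + d)) + ((e + f) + g))
    regions = solve-∀

suc*≢0 : ∀ k {m} → 1 ≤ m → suc k * m ≢ 0
suc*≢0 k {suc m} _ ()

△-distinct : ∀ {n m} {I J : Subset n} → 1 ≤ m → IsPoint m (I △ J) → I ≢ J
△-distinct {I = I} 1≤m pIJ refl = suc*≢0 1 1≤m (trans (sym pIJ) (∣△-self∣ I))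

collinear : ∀ {n m} {I J : Subset n} → 1 ≤ m → IsPoint m I → IsPoint m J → IsPoint m (I △ J) → Collinear m I J
collinear 1≤m pI pJ pIJ = pI , pJ , △-distinct 1≤m pIJ , pIJ

collinear-sym : ∀ {n m} {I J : Subset n} → Collinear m I J → Collinear m J I
collinear-sym {m = m} {I} {J} (pI , pJ , I≢J , pIJ) = pJ , pI , I≢J ∘ sym , subst (IsPoint m) (△-comm I J) pIJ

collinear-△ˡ : ∀ {n m} {I J : Subset n} → 1 ≤ m → Collinear m I J → Collinear m I (I △ J)
collinear-△ˡ {m = m} {I} {J} 1≤m (pI , pJ , _ , pIJ) =
  collinear 1≤m pI pIJ (subst (IsPoint m) (sym (△-cancelˡ I J)) pJ)

collinear-△ʳ : ∀ {n m} {I J : Subset n} → 1 ≤ m → Collinear m I J → Collinear m J (I △ J)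
collinear-△ʳ {m = m} {I} {J} 1≤m IJ = subst (Collinear m J) (△-comm J I) (collinear-△ˡ 1≤m (collinear-sym {m = m} IJ))

∼⇔∣△∣ : ∀ {n m} {P X : Subset n} → 1 ≤ m → IsPoint m P → IsPoint m X →
  P ∼[ m ] X ⇔ (∣ P △ X ∣ ≡ 0 ⊎ ∣ P △ X ∣ ≡ 2 * m)
∼⇔∣△∣ {m = m} {P} {X} 1≤m pP pX = mk⇔ distance point
  where
  distance : P ∼[ m ] X → ∣ P △ X ∣ ≡ 0 ⊎ ∣ P △ X ∣ ≡ 2 * m
  distance (inj₁ refl)             = inj₁ (∣△-self∣ P)
  distance (inj₂ (_ , _ , _ , pPX)) = inj₂ pPX
  point : ∣ P △ X ∣ ≡ 0 ⊎ ∣ P △ X ∣ ≡ 2 * m → P ∼[ m ] X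
  point (inj₁ ∣P△X∣≡0) = inj₁ (∣△∣≡0⇒≡ P X ∣P△X∣≡0)
  point (inj₂ pPX)     = inj₂ (collinear 1≤m pP pX pPX)

onLine-point : ∀ {n m} {I J X : Subset n} → Collinear m I J → OnLine I J X → IsPoint m X
onLine-point (pI , _ , _ , _)   (inj₁ refl)        = pI
onLine-point (_ , pJ , _ , _)   (inj₂ (inj₁ refl)) = pJ
onLine-point (_ , _ , _ , pIJ)  (inj₂ (inj₂ refl)) = pIJ

onLine-collinear : ∀ {n m} {I J X Y : Subset n} → 1 ≤ m → Collinear m I J →
  OnLine I J X → OnLine I J Y → X ≢ Y → Collinear m X Y
onLine-collinear {m = m} 1≤m IJ (inj₁ refl)        (inj₁ refl)        X≢Y = ⊥-elim (X≢Y refl)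
onLine-collinear {m = m} 1≤m IJ (inj₁ refl)        (inj₂ (inj₁ refl)) X≢Y = IJ
onLine-collinear {m = m} 1≤m IJ (inj₁ refl)        (inj₂ (inj₂ refl)) X≢Y = collinear-△ˡ 1≤m IJ
onLine-collinear {m = m} 1≤m IJ (inj₂ (inj₁ refl)) (inj₁ refl)        X≢Y = collinear-sym {m = m} IJ
onLine-collinear {m = m} 1≤m IJ (inj₂ (inj₁ refl)) (inj₂ (inj₁ refl)) X≢Y = ⊥-elim (X≢Y refl)
onLine-collinear {m = m} 1≤m IJ (inj₂ (inj₁ refl)) (inj₂ (inj₂ refl)) X≢Y = collinear-△ʳ 1≤m IJ
onLine-collinear {m = m} 1≤m IJ (inj₂ (inj₂ refl)) (inj₁ refl)        X≢Y = collinear-sym {m = m} (collinear-△ˡ 1≤m IJ)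
onLine-collinear {m = m} 1≤m IJ (inj₂ (inj₂ refl)) (inj₂ (inj₁ refl)) X≢Y = collinear-sym {m = m} (collinear-△ʳ 1≤m IJ)
onLine-collinear {m = m} 1≤m IJ (inj₂ (inj₂ refl)) (inj₂ (inj₂ refl)) X≢Y = ⊥-elim (X≢Y refl)

lineSet : ∀ {n} → Subset n → Subset n → PointSet n
lineSet I J X = does (X ≟ₛ I) ∨ does (X ≟ₛ J) ∨ does (X ≟ₛ (I △ J))

∈lineSet⇔ : ∀ {n} {I J X : Subset n} → X ∈ₛ lineSet I J ⇔ OnLine I J X
∈lineSet⇔ {I = I} {J} {X} with X ≟ₛ I | X ≟ₛ J | X ≟ₛ (I △ J)
... | yes X≡I | _       | _       = mk⇔ (λ _ → inj₁ X≡I) (λ _ → refl)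
... | no _    | yes X≡J | _       = mk⇔ (λ _ → inj₂ (inj₁ X≡J)) (λ _ → refl)
... | no _    | no _    | yes X≡K = mk⇔ (λ _ → inj₂ (inj₂ X≡K)) (λ _ → refl)
... | no X≢I  | no X≢J  | no X≢K  = mk⇔ (λ ()) (⊥-elim ∘ [ X≢I , [ X≢J , X≢K ]′ ]′)

line-clique : ∀ {n m} {I J : Subset n} {C : PointSet n} → 1 ≤ m → Collinear m I J →
  (∀ X → X ∈ₛ C ⇔ OnLine I J X) → IsClique m C
line-clique {m = m} 1≤m IJ C≐IJ =
  (λ X X∈C → onLine-point {m = m} IJ (to (C≐IJ X) X∈C)) ,
  (λ X Y X∈C Y∈C → onLine-collinear {m = m} 1≤m IJ (to (C≐IJ X) X∈C) (to (C≐IJ Y) Y∈C))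

choose : ∀ {n} (Y Z : Subset n) (t₁ t₂ t₃ t₄ : ℕ) → Σ (Subset n) λ Q → let open Venn Q Y Z in
  a ≡ t₁ ⊓ (a + e) × b ≡ t₂ ⊓ (b + f) × c ≡ t₃ ⊓ (c + g) × d ≡ t₄ ⊓ (d + h)
choose [] [] t₁ t₂ t₃ t₄ = [] , sym (⊓-zeroʳ t₁) , sym (⊓-zeroʳ t₂) , sym (⊓-zeroʳ t₃) , sym (⊓-zeroʳ t₄)
choose (true ∷ Y) (true ∷ Z) zero t₂ t₃ t₄ = Product.map (false ∷_) id (choose Y Z 0 t₂ t₃ t₄)
choose (true ∷ Y) (true ∷ Z) (suc t₁) t₂ t₃ t₄ =
  Product.map (true ∷_) (Product.map₁ (cong suc)) (choose Y Z t₁ t₂ t₃ t₄)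
choose (true ∷ Y) (false ∷ Z) t₁ zero t₃ t₄ = Product.map (false ∷_) id (choose Y Z t₁ 0 t₃ t₄)
choose (true ∷ Y) (false ∷ Z) t₁ (suc t₂) t₃ t₄ =
  Product.map (true ∷_) (Product.map₂ (Product.map₁ (cong suc))) (choose Y Z t₁ t₂ t₃ t₄)
choose (false ∷ Y) (true ∷ Z) t₁ t₂ zero t₄ = Product.map (false ∷_) id (choose Y Z t₁ t₂ 0 t₄)
choose (false ∷ Y) (true ∷ Z) t₁ t₂ (suc t₃) t₄ =
  Product.map (true ∷_) (Product.map₂ (Product.map₂ (Product.map₁ (cong suc)))) (choose Y Z t₁ t₂ t₃ t₄)
choose (false ∷ Y) (false ∷ Z) t₁ t₂ t₃ zero = Product.map (false ∷_) id (choose Y Z t₁ t₂ t₃ 0)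
choose (false ∷ Y) (false ∷ Z) t₁ t₂ t₃ (suc t₄) =
  Product.map (true ∷_) (Product.map₂ (Product.map₂ (Product.map₂ (cong suc)))) (choose Y Z t₁ t₂ t₃ t₄)

regroup : ∀ a b c d e f g h →
  ((a + b) + (c + d)) + ((e + f) + (g + h)) ≡ (a + e) + ((b + f) + ((c + g) + (d + h)))
regroup = solve-∀

⊓-bounded : ∀ {x t y} → t ≤ y → x ≡ t ⊓ y → x ≡ t
⊓-bounded t≤y x≡t⊓y = trans x≡t⊓y (m≤n⇒m⊓n≡m t≤y)

halve : ∀ {A B C m} → A + B ≡ 2 * m → A + C ≡ 2 * m → B + C ≡ 2 * m → A ≡ m
halve {A} {B} {C} {m} AB AC BC = *-cancelˡ-≡ A m 2 (+-cancelʳ-≡ (2 * m) (2 * A) (2 * m) (begin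
  2 * A + 2 * m       ≡⟨ cong (2 * A +_) BC ⟨
  2 * A + (B + C)     ≡⟨ double A B C ⟩
  (A + B) + (A + C)   ≡⟨ cong₂ _+_ AB AC ⟩
  2 * m + 2 * m       ∎))
  where
  open ≡-Reasoning
  double : ∀ A B C → 2 * A + (B + C) ≡ (A + B) + (A + C)
  double = solve-∀

-- Y and Z at distance 2m, both of size 2m, split into Y ∩ Z, Y ─ Z, Z ─ Y of m points each.
equidistant : ∀ {a b c e f g m} →
  (a + b) + (e + f) ≡ 2 * m → (a + c) + (e + g) ≡ 2 * m → (b + c) + (f + g) ≡ 2 * m →
  a + e ≡ m × b + f ≡ m × c + g ≡ m
equidistant {a} {b} {c} {e} {f} {g} ∣Y∣ ∣Z∣ ∣Y△Z∣ =
  halve AB AC BC , halve (trans (+-comm (b + f) (a + e)) AB) BC AC ,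
  halve (trans (+-comm (c + g) (a + e)) AC) (trans (+-comm (c + g) (b + f)) BC) AB
  where
  pair : ∀ a b e f → (a + e) + (b + f) ≡ (a + b) + (e + f)
  pair = solve-∀
  AB = trans (pair a b e f) ∣Y∣
  AC = trans (pair a c e g) ∣Z∣
  BC = trans (pair b c f g) ∣Y△Z∣

witness-regions : ∀ {a b c d e f g h t s} →
  (a + b) + (e + f) ≡ 2 * (t + s) → (a + c) + (e + g) ≡ 2 * (t + s) → (b + c) + (f + g) ≡ 2 * (t + s) →
  3 * (t + s) + t ≤ ((a + b) + (c + d)) + ((e + f) + (g + h)) →
  a ≡ t ⊓ (a + e) → b ≡ s ⊓ (b + f) → c ≡ s ⊓ (c + g) → d ≡ t ⊓ (d + h) →
  a ≡ t × b ≡ s × c ≡ s × d ≡ t × e ≡ s × f ≡ t × g ≡ t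
witness-regions {a} {b} {c} {d} {e} {f} {g} {h} {t} {s} ∣Y∣ ∣Z∣ ∣Y△Z∣ bound a= b= c= d= =
  a≡t , b≡s , c≡s , d≡t , e≡s , f≡t , g≡t
  where
  sides = equidistant {a} {b} {c} {e} {f} {g} ∣Y∣ ∣Z∣ ∣Y△Z∣
  ae = proj₁ sides
  bf = proj₁ (proj₂ sides)
  cg = proj₂ (proj₂ sides)
  a≡t = ⊓-bounded (subst (t ≤_) (sym ae) (m≤m+n t s)) a=
  b≡s = ⊓-bounded (subst (s ≤_) (sym bf) (m≤n+m s t)) b=
  c≡s = ⊓-bounded (subst (s ≤_) (sym cg) (m≤n+m s t)) c=
  e≡s = +-cancelˡ-≡ t e s (trans (cong (_+ e) (sym a≡t)) ae)
  f≡t = +-cancelˡ-≡ s f t (trans (cong (_+ f) (sym b≡s)) (trans bf (+-comm t s)))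
  g≡t = +-cancelˡ-≡ s g t (trans (cong (_+ g) (sym c≡s)) (trans cg (+-comm t s)))
  thrice : ∀ m x → m + (m + (m + x)) ≡ 3 * m + x
  thrice = solve-∀
  outside : ((a + b) + (c + d)) + ((e + f) + (g + h)) ≡ 3 * (t + s) + (d + h)
  outside = begin
    ((a + b) + (c + d)) + ((e + f) + (g + h)) ≡⟨ regroup a b c d e f g h ⟩
    (a + e) + ((b + f) + ((c + g) + (d + h))) ≡⟨ cong₂ _+_ ae (cong₂ _+_ bf (cong (_+ (d + h)) cg)) ⟩
    (t + s) + ((t + s) + ((t + s) + (d + h))) ≡⟨ thrice (t + s) (d + h) ⟩
    3 * (t + s) + (d + h)                     ∎
    where open ≡-Reasoning
  d≡t = ⊓-bounded (+-cancelˡ-≤ (3 * (t + s)) t (d + h) (subst (3 * (t + s) + t ≤_) outside bound)) d=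

witness-sizes : ∀ {a b c d e f g t s} → a ≡ t × b ≡ s × c ≡ s × d ≡ t × e ≡ s × f ≡ t × g ≡ t →
  (a + b) + (c + d) ≡ 2 * (t + s) × (c + d) + (e + f) ≡ 2 * (t + s) ×
  (b + d) + (e + g) ≡ 2 * (t + s) × (a + d) + (f + g) ≡ 4 * t
witness-sizes {t = t} {s} (refl , refl , refl , refl , refl , refl , refl) = ts t s , st t s , st t s , tt t
  where
  ts : ∀ t s → (t + s) + (s + t) ≡ 2 * (t + s)
  ts = solve-∀
  st : ∀ t s → (s + t) + (s + t) ≡ 2 * (t + s)
  st = solve-∀
  tt : ∀ t → (t + t) + (t + t) ≡ 4 * t
  tt = solve-∀

neighbour-sizes : ∀ {a b c d e f g h m} →
  (b + c) + (f + g) ≡ 0 → a ≡ m ⊓ (a + e) → d ≡ m ⊓ (d + h) → (a + b) + (e + f) ≡ 2 * m →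
  3 * m ≤ ((a + b) + (c + d)) + ((e + f) + (g + h)) →
  (a + b) + (c + d) ≡ 2 * m × (c + d) + (e + f) ≡ 2 * m
neighbour-sizes {b = suc _} () _ _ _ _
neighbour-sizes {b = zero} {suc _} () _ _ _ _
neighbour-sizes {b = zero} {zero} {f = suc _} () _ _ _ _
neighbour-sizes {b = zero} {zero} {f = zero} {suc _} () _ _ _ _
neighbour-sizes {a} {zero} {zero} {d} {e} {zero} {zero} {h} {m} refl a= d= ∣Y∣ bound =
  trans (cong₂ _+_ (trans (+-identityʳ a) a≡m) d≡m) (twice m) ,
  trans (cong₂ _+_ d≡m (trans (+-identityʳ e) e≡m)) (twice m)
  where
  twice : ∀ m → m + m ≡ 2 * m
  twice = solve-∀
  ae : a + e ≡ 2 * m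
  ae = trans (sym (cong₂ _+_ (+-identityʳ a) (+-identityʳ e))) ∣Y∣
  a≡m : a ≡ m
  a≡m = ⊓-bounded (subst (m ≤_) (sym ae) (m≤m+n m (m + 0))) a=
  e≡m : e ≡ m
  e≡m = +-cancelˡ-≡ m e m (trans (cong (_+ e) (sym a≡m)) (trans ae (sym (twice m))))
  outside : ((a + 0) + (0 + d)) + ((e + 0) + (0 + h)) ≡ 2 * m + (d + h)
  outside = trans (regroup a 0 0 d e 0 0 h) (cong (_+ (d + h)) ae)
  thrice : ∀ m → 3 * m ≡ 2 * m + m
  thrice = solve-∀
  d≡m : d ≡ m
  d≡m = ⊓-bounded (+-cancelˡ-≤ (2 * m) m (d + h) (subst₂ _≤_ (thrice m) outside bound)) d=

-- Maximal cliques for n = 3m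

neighbour : ∀ {n m} {I : Subset n} → 1 ≤ m → 3 * m ≤ n → IsPoint m I → ∃ λ J → Collinear m I J
neighbour {n} {m} {I} 1≤m 3m≤n pI with choose I I m 0 0 m
... | Q , a= , _ , _ , d= = Q , collinear-sym {m = m} (collinear 1≤m pQ pI pQI)
  where
  open Venn Q I I
  sizes = neighbour-sizes {a} {b} {c} {d} {e} {f} {g} {h}
    (trans (sym ∣Y△Z∣) (∣△-self∣ I)) a= d= (trans (sym ∣Y∣) pI) (subst (3 * m ≤_) ∣⊤∣ 3m≤n)
  pQ = trans ∣X∣ (proj₁ sizes)
  pQI = trans ∣X△Y∣ (proj₂ sizes)

thirdPoint : ∀ {n m} {X I J : Subset n} → n ≡ 3 * m → IsPoint m X → Collinear m I J →
  Collinear m X I → Collinear m X J → X ≡ I △ J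
thirdPoint {n} {m} {X} {I} {J} n≡3m pX (pI , pJ , _ , pIJ) (_ , _ , _ , pXI) (_ , _ , _ , pXJ) =
  ∣△∣≡0⇒≡ X (I △ J) (n≤0⇒n≡0 (+-cancelˡ-≤ (12 * m) _ 0 (begin
    12 * m + w
      ≡⟨ sum-of-sizes m w ⟨
    2 * m + 2 * m + 2 * m + 2 * m + 2 * m + 2 * m + w
      ≡⟨ cong (λ k → k + w) (sym (cong₂ _+_ (cong₂ _+_ (cong₂ _+_ (cong₂ _+_ (cong₂ _+_ pX pI) pJ) pXI) pXJ) pIJ)) ⟩
    ∣ X ∣ + ∣ I ∣ + ∣ J ∣ + ∣ X △ I ∣ + ∣ X △ J ∣ + ∣ I △ J ∣ + w
      ≡⟨ Venn.∣combinations∣ X I J ⟩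
    4 * ∣ X ∪ (I ∪ J) ∣
      ≤⟨ *-monoʳ-≤ 4 (∣p∣≤n (X ∪ (I ∪ J))) ⟩
    4 * n
      ≡⟨ cong (4 *_) n≡3m ⟩
    4 * (3 * m)
      ≡⟨ twelve m ⟩
    12 * m + 0 ∎)))
  where
  open ≤-Reasoning
  w = ∣ X △ (I △ J) ∣
  sum-of-sizes : ∀ m w → 2 * m + 2 * m + 2 * m + 2 * m + 2 * m + 2 * m + w ≡ 12 * m + w
  sum-of-sizes = solve-∀
  twelve : ∀ m → 4 * (3 * m) ≡ 12 * m + 0
  twelve = solve-∀

clique-onLine : ∀ {n m} {C : PointSet n} {I J : Subset n} → n ≡ 3 * m → IsClique m C →
  I ∈ₛ C → J ∈ₛ C → Collinear m I J → ∀ X → X ∈ₛ C → OnLine I J X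
clique-onLine {m = m} {I = I} {J} n≡3m (points , adjacent) I∈C J∈C IJ X X∈C with X ≟ₛ I | X ≟ₛ J
... | yes X≡I | _       = inj₁ X≡I
... | no _    | yes X≡J = inj₂ (inj₁ X≡J)
... | no X≢I  | no X≢J  =
  inj₂ (inj₂ (thirdPoint {m = m} n≡3m (points X X∈C) IJ (adjacent X I X∈C I∈C X≢I) (adjacent X J X∈C J∈C X≢J)))

subsingleton⊆line : ∀ {n m} {C : PointSet n} {I : Subset n} → 1 ≤ m → 3 * m ≤ n → IsPoint m I →
  (∀ X → X ∈ₛ C → X ≡ I) → ∃₂ λ I J → Collinear m I J × (∀ X → X ∈ₛ C → OnLine I J X)
subsingleton⊆line {m = m} {I = I} 1≤m 3m≤n pI C⊆I =
  let J , IJ = neighbour {m = m} {I} 1≤m 3m≤n pI in I , J , IJ , λ X X∈C → inj₁ (C⊆I X X∈C)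

clique⊆line : ∀ {n m} {C : PointSet n} → n ≡ 3 * m → 1 ≤ m → IsClique m C →
  ∃₂ λ I J → Collinear m I J × (∀ X → X ∈ₛ C → OnLine I J X)
clique⊆line {n} {m} {C} n≡3m 1≤m (points , adjacent) with anySubset? (λ I → C I Bool.≟ true)
... | no ∄I =
  let I , pI = subsetOfSize {n} {2 * m} (≤-trans (*-monoˡ-≤ m (m≤n+m 2 1)) (≤-reflexive (sym n≡3m)))
  in subsingleton⊆line {m = m} {I = I} 1≤m (≤-reflexive (sym n≡3m)) pI (λ X X∈C → ⊥-elim (∄I (X , X∈C)))
... | yes (I , I∈C) with anySubset? (λ J → (C J Bool.≟ true) ×-dec ¬? (J ≟ₛ I))
...   | no ∄J = subsingleton⊆line {m = m} 1≤m (≤-reflexive (sym n≡3m)) (points I I∈C)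
                  (λ X X∈C → decidable-stable (X ≟ₛ I) (λ X≢I → ∄J (X , X∈C , X≢I)))
...   | yes (J , J∈C , J≢I) =
  let IJ = adjacent I J I∈C J∈C (J≢I ∘ sym)
  in I , J , IJ , clique-onLine {m = m} n≡3m (points , adjacent) I∈C J∈C IJ

maximalClique⇔line : ∀ {n m} → n ≡ 3 * m → 1 ≤ m → (C : PointSet n) → IsMaximalClique m C ⇔ IsLine m C
maximalClique⇔line {n} {m} n≡3m 1≤m C = mk⇔ toLine fromLine
  where
  toLine : IsMaximalClique m C → IsLine m C
  toLine (clique , maximal) =
    let I , J , IJ , C⊆IJ = clique⊆line n≡3m 1≤m clique
        IJ⊆C : ∀ X → OnLine I J X → X ∈ₛ C
        IJ⊆C X X∈IJ = maximal (lineSet I J) (line-clique {m = m} 1≤m IJ (λ _ → ∈lineSet⇔))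
                        (λ Y Y∈C → from ∈lineSet⇔ (C⊆IJ Y Y∈C)) X (from ∈lineSet⇔ X∈IJ)
    in I , J , IJ , λ X → mk⇔ (C⊆IJ X) (IJ⊆C X)
  fromLine : IsLine m C → IsMaximalClique m C
  fromLine (I , J , IJ , C≐IJ) = line-clique {m = m} 1≤m IJ C≐IJ , maximal
    where
    maximal : ∀ D → IsClique m D → (∀ X → X ∈ₛ C → X ∈ₛ D) → ∀ X → X ∈ₛ D → X ∈ₛ C
    maximal D D-clique C⊆D X X∈D = from (C≐IJ X)
      (clique-onLine {m = m} n≡3m D-clique I∈D J∈D IJ X X∈D)
      where
      I∈D = C⊆D I (from (C≐IJ I) (inj₁ refl))
      J∈D = C⊆D J (from (C≐IJ J) (inj₂ (inj₁ refl)))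

-- The witness property

4t≢2[t+s] : ∀ t s → t ≢ s → 4 * t ≢ 2 * (t + s)
4t≢2[t+s] t s t≢s 4t≡2[t+s] =
  t≢s (+-cancelˡ-≡ t t s (*-cancelˡ-≡ (t + t) (t + s) 2 (trans (double t) 4t≡2[t+s])))
  where
  double : ∀ t → 2 * (t + t) ≡ 4 * t
  double = solve-∀

witness : ∀ {n} t s → 1 ≤ t → t ≢ s → 3 * (t + s) + t ≤ n → WitnessProperty n (t + s)
witness {n} t s 1≤t t≢s bound P P' (pP , pP' , _ , pPP') with choose P P' t s s t
... | Q , a= , b= , c= , d= =
  Q , pQ , collinear 1≤m pQ pP pQP , collinear 1≤m pQ pP' pQP' , Q≁P△P'
  where
  open Venn Q P P'
  1≤m = ≤-trans 1≤t (m≤m+n t s)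
  sizes = witness-sizes (witness-regions {a} {b} {c} {d} {e} {f} {g} {h}
    (trans (sym ∣Y∣) pP) (trans (sym ∣Z∣) pP') (trans (sym ∣Y△Z∣) pPP') (subst (_ ≤_) ∣⊤∣ bound) a= b= c= d=)
  pQ = trans ∣X∣ (proj₁ sizes)
  pQP = trans ∣X△Y∣ (proj₁ (proj₂ sizes))
  pQP' = trans ∣X△Z∣ (proj₁ (proj₂ (proj₂ sizes)))
  ∣Q△[P△P']∣ = trans ∣X△[Y△Z]∣ (proj₂ (proj₂ (proj₂ sizes)))
  Q≁P△P' : ¬ Q ∼[ t + s ] (P △ P')
  Q≁P△P' Q∼P△P' with to (∼⇔∣△∣ {m = t + s} 1≤m pQ pPP') Q∼P△P'
  ... | inj₁ ∣Q△P△P'∣≡0 = suc*≢0 3 1≤t (trans (sym ∣Q△[P△P']∣) ∣Q△P△P'∣≡0)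
  ... | inj₂ pQ△P△P' = 4t≢2[t+s] t s t≢s (trans (sym ∣Q△[P△P']∣) pQ△P△P')

witnessProperty : ∀ {n} m → 1 ≤ m → 3 * m + 1 ≤ n → ¬ (n ≡ 7 × m ≡ 2) → WitnessProperty n m
witnessProperty 1                   _ bound _     = witness 1 0 ≤-refl (λ ()) bound
witnessProperty 2                   _ bound ≢7,2 = witness 2 0 (s≤s z≤n) (λ ()) (≤∧≢⇒< bound (≢7,2 ∘ (_, refl) ∘ sym))
witnessProperty (suc (suc (suc k))) _ bound _     = witness 1 (suc (suc k)) ≤-refl (λ ()) bound

-- The polar space for n = 7, m = 2

odd : ℕ → Bool
odd zero    = false
odd (suc n) = not (odd n)

odd-+ : ∀ m n → odd (m + n) ≡ odd m xor odd n
odd-+ zero    n = refl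
odd-+ (suc m) n = trans (cong not (odd-+ m n)) (Bool.not-distribˡ-xor (odd m) (odd n))

odd-∣∩△∣ : ∀ {n} (P I J : Subset n) → odd ∣ P ∩ (I △ J) ∣ ≡ odd ∣ P ∩ I ∣ xor odd ∣ P ∩ J ∣
odd-∣∩△∣ P I J = begin
  odd ∣ P ∩ (I △ J) ∣               ≡⟨ cong odd ∣X∩[Y△Z]∣ ⟩
  odd (b + c)                       ≡⟨ Bool.xor-identityʳ (odd (b + c)) ⟨
  odd (b + c) xor false             ≡⟨ cong (odd (b + c) xor_) (Bool.xor-same (odd a)) ⟨
  odd (b + c) xor (odd a xor odd a) ≡⟨ cong (odd (b + c) xor_) (odd-+ a a) ⟨
  odd (b + c) xor odd (a + a)       ≡⟨ odd-+ (b + c) (a + a) ⟨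
  odd ((b + c) + (a + a))           ≡⟨ cong odd (shuffle a b c) ⟩
  odd ((a + b) + (a + c))           ≡⟨ odd-+ (a + b) (a + c) ⟩
  odd (a + b) xor odd (a + c)       ≡⟨ cong₂ (λ k l → odd k xor odd l) ∣X∩Y∣ ∣X∩Z∣ ⟨
  odd ∣ P ∩ I ∣ xor odd ∣ P ∩ J ∣   ∎
  where
  open ≡-Reasoning
  open Venn P I J
  shuffle : ∀ a b c → (b + c) + (a + a) ≡ (a + b) + (a + c)
  shuffle = solve-∀

-- k = ∣P ∩ X∣, u = ∣P ─ X∣, w = ∣X ─ P∣ for two 4-sets P, X in a 7-set.
meet-parity : ∀ {k u w r} → k + u ≡ 4 → k + w ≡ 4 → (k + u) + (w + r) ≡ 7 →
  (u + w ≡ 0 ⊎ u + w ≡ 4) ⇔ odd k ≡ false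
meet-parity {0} refl refl ()
meet-parity {1} refl refl _ = mk⇔ (λ { (inj₁ ()) ; (inj₂ ()) }) (λ ())
meet-parity {2} refl refl _ = mk⇔ (λ _ → refl) (λ _ → inj₂ refl)
meet-parity {3} refl refl _ = mk⇔ (λ { (inj₁ ()) ; (inj₂ ()) }) (λ ())
meet-parity {4} refl refl _ = mk⇔ (λ _ → refl) (λ _ → inj₁ refl)
meet-parity {suc (suc (suc (suc (suc _))))} () _ _

∼⇔even∣∩∣ : ∀ {P X : Subset 7} → IsPoint 2 P → IsPoint 2 X → P ∼[ 2 ] X ⇔ odd ∣ P ∩ X ∣ ≡ false
∼⇔even∣∩∣ {P} {X} pP pX =
  subst₂ (λ δ k → (δ ≡ 0 ⊎ δ ≡ 4) ⇔ odd k ≡ false) (sym ∣X△Y∣) (sym ∣X∩Y∣)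
    (meet-parity {a + b} {c + d} {e + f} {g + h} (trans (sym ∣X∣) pP) (trans (sym ∣Y∣) pX) (sym ∣⊤∣))
  ⇔-∘ ∼⇔∣△∣ {m = 2} (s≤s z≤n) pP pX
  where open Venn P X X

oneOrAll-of-linear : ∀ {n} {I J : Subset n} (R : Subset n → Set) (ρ : Subset n → Bool) →
  (∀ X → OnLine I J X → R X ⇔ ρ X ≡ false) → ρ (I △ J) ≡ ρ I xor ρ J →
  (∀ X → OnLine I J X → R X) ⊎ (Σ (Subset n) λ X → OnLine I J X × R X × (∀ Y → OnLine I J Y → R Y → Y ≡ X))
oneOrAll-of-linear {n} {I} {J} R ρ R⇔ ρ-linear = classify (ρ I) (ρ J) refl refl ρ-linear
  where
  onI : OnLine I J I
  onI = inj₁ refl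
  onJ : OnLine I J J
  onJ = inj₂ (inj₁ refl)
  onK : OnLine I J (I △ J)
  onK = inj₂ (inj₂ refl)
  R⁺ : ∀ {X} → OnLine I J X → ρ X ≡ false → R X
  R⁺ on = from (R⇔ _ on)
  R⁻ : ∀ {X} → OnLine I J X → ρ X ≡ true → ¬ R X
  R⁻ on ρX RX with trans (sym ρX) (to (R⇔ _ on) RX)
  ... | ()
  classify : ∀ x y → ρ I ≡ x → ρ J ≡ y → ρ (I △ J) ≡ x xor y →
    (∀ X → OnLine I J X → R X) ⊎ (Σ (Subset n) λ X → OnLine I J X × R X × (∀ Y → OnLine I J Y → R Y → Y ≡ X))
  classify false false ρI ρJ ρK = inj₁ λ { _ (inj₁ refl) → R⁺ onI ρI ; _ (inj₂ (inj₁ refl)) → R⁺ onJ ρJ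
                                         ; _ (inj₂ (inj₂ refl)) → R⁺ onK ρK }
  classify false true ρI ρJ ρK = inj₂ (I , onI , R⁺ onI ρI ,
    λ { _ (inj₁ refl) _ → refl ; _ (inj₂ (inj₁ refl)) RJ → ⊥-elim (R⁻ onJ ρJ RJ)
      ; _ (inj₂ (inj₂ refl)) RK → ⊥-elim (R⁻ onK ρK RK) })
  classify true false ρI ρJ ρK = inj₂ (J , onJ , R⁺ onJ ρJ ,
    λ { _ (inj₁ refl) RI → ⊥-elim (R⁻ onI ρI RI) ; _ (inj₂ (inj₁ refl)) _ → refl
      ; _ (inj₂ (inj₂ refl)) RK → ⊥-elim (R⁻ onK ρK RK) })
  classify true true ρI ρJ ρK = inj₂ (I △ J , onK , R⁺ onK ρK ,
    λ { _ (inj₁ refl) RI → ⊥-elim (R⁻ onI ρI RI) ; _ (inj₂ (inj₁ refl)) RJ → ⊥-elim (R⁻ onJ ρJ RJ)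
      ; _ (inj₂ (inj₂ refl)) _ → refl })

polarSpace : IsPolarSpace 7 2
polarSpace I J IJ P pP =
  oneOrAll-of-linear (P ∼[ 2 ]_) (λ X → odd ∣ P ∩ X ∣) (λ X on → ∼⇔even∣∩∣ pP (onLine-point {m = 2} IJ on))
    (odd-∣∩△∣ P I J)

proposition2p2 : ∀ (m n : ℕ) → 1 ≤ m → 3 * m ≤ n →
    (n ≡ 3 * m → ∀ (C : PointSet n) → IsMaximalClique m C ⇔ IsLine m C)
    × (3 * m + 1 ≤ n →
        ((n ≡ 7 × m ≡ 2) → IsPolarSpace n m)
        × (¬ (n ≡ 7 × m ≡ 2) → WitnessProperty n m))
proposition2p2 m n 1≤m _ =
  (λ n≡3m → maximalClique⇔line n≡3m 1≤m) ,
  λ 3m+1≤n → (λ { (refl , refl) → polarSpace }) , witnessProperty m 1≤m 3m+1≤n
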